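{- Let $n\ge2$ and $k\ge1$ be integers. Then \[ \gamma_{[k]R}(C_8\Box P_n)\le 2n(k+1)-\left(\left\lfloor\frac{n-2}{5}\right\rfloor+\left\lfloor\frac n5\right\rfloor\right)+2k. \]
   Context: For a graph $G$ and $v\in V(G)$, $N(v)$ is the open neighborhood and $N[v]=N(v)\cup\{v\}$. For an integer $k\ge1$, a function $f:V(G)\to\{0,1,\dots,k+1\}$ is a $[k]$-Roman dominating function if for every vertex $v$ with $f(v)<k$ we have $\sum_{u\in N[v]}f(u)\ge k+|\{u\in N(v): f(u)>0\}|$. The weight of $f$ is $\sum_{v}f(v)$, and $\gamma_{[k]R}(G)$ is the minimum weight of a $[k]$-Roman dominating function on $G$. $C_m\Box P_n$ is the Cartesian product of the cycle $C_m$ (vertices $0,\dots,m-1$ mod $m$) and the path $P_n$ (vertices $0,\dots,n-1$): $(i,j)\sim(i',j')$ iff ($i=i'$ and $|j-j'|=1$) or ($j=j'$ and $i'\equiv i\pm1 \pmod m$). -}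

module Defs where

open import Data.Nat using (ℕ; zero; suc; _+_; _*_; _∸_; _<_; _≥_; _≤_; _≡ᵇ_)
open import Data.Bool using (Bool; true; false; _∧_; _∨_; if_then_else_)
open import Data.Fin using (Fin; toℕ)
open import Data.Product using (_×_; _,_; Σ)
open import Relation.Binary.PropositionalEquality using (_≡_)

∑ : ∀ {m} → (Fin m → ℕ) → ℕ
∑ {zero}  f = 0
∑ {suc m} f = f Fin.zero + ∑ (λ i → f (Fin.suc i))
  where import Data.Fin as Fin


dist1 : ℕ → ℕ → Bool
dist1 x y = (suc x ≡ᵇ y) ∨ (suc y ≡ᵇ x)

-- Cartesian product C_m □ P_n on vertex set Fin m × Fin n,
-- encoded as Fin m → Fin n pairs via a function on pairs
-- adjacency: (i,j) ~ (i',j') iff (i = i' and |j-j'| = 1) or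
--            (j = j' and i' ≡ i ± 1 (mod m))
cycAdj : (m : ℕ) → ℕ → ℕ → Bool
cycAdj m i i' = (suc i ≡ᵇ i') ∨ (suc i' ≡ᵇ i)
              ∨ (((suc i ≡ᵇ m) ∧ (i' ≡ᵇ 0)) ∨ ((suc i' ≡ᵇ m) ∧ (i ≡ᵇ 0)))

CPadj : (m n : ℕ) → (Fin m × Fin n) → (Fin m × Fin n) → Bool
CPadj m n (i , j) (i' , j') =
  ((toℕ i ≡ᵇ toℕ i') ∧ dist1 (toℕ j) (toℕ j'))
  ∨ ((toℕ j ≡ᵇ toℕ j') ∧ cycAdj m (toℕ i) (toℕ i'))

∑₂ : ∀ {m n} → (Fin m × Fin n → ℕ) → ℕ
∑₂ f = ∑ (λ i → ∑ (λ j → f (i , j)))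

indicator : Bool → ℕ → ℕ
indicator b x = if b then x else 0

positive : ℕ → ℕ
positive zero    = 0
positive (suc _) = 1

IsKRDF-CP : (k m n : ℕ) → (Fin m × Fin n → ℕ) → Set
IsKRDF-CP k m n f =
  (∀ v → f v ≤ suc k) ×
  (∀ v → f v < k →
     f v + ∑₂ (λ u → indicator (CPadj m n v u) (f u))
       ≥ k + ∑₂ (λ u → indicator (CPadj m n v u) (positive (f u))))

weight : ∀ {m n} → (Fin m × Fin n → ℕ) → ℕ
weight f = ∑₂ f

{-# OPTIONS --safe #-}
module Submission where

-- Label the vertices O, K, K⁺, with values 0, k, k + 1. If every O-vertex has a
-- K⁺-neighbour, the labelling is a [k]-Roman dominating function: write the value
-- of each neighbour u as [f u > 0] + pred (f u); the K⁺-neighbour alone makes the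
-- second part at least k. On C₈ □ Pₙ such a labelling is built column by column.
-- Every inner column carries two labels, K⁺K⁺ or, in two of every five columns of
-- a period-5 pattern, K K⁺; the first and last columns carry one more K. Hence the
-- weight is k(2n + 2) + 4 + (number of K⁺ in inner columns), and the period saves
-- at least ⌊(n - 2)/5⌋ + ⌊n/5⌋ on the 2(n - 2) that inner columns would otherwise cost.

open import Defs
open import Data.Bool using (Bool; true; false; _∧_; _∨_)
open import Data.Bool.Properties using () renaming (_≟_ to _≟ᵇ_)
open import Data.Fin using (Fin; zero; suc; toℕ; inject₁; fromℕ)
open import Data.Fin.Patterns using (0F; 1F; 2F; 3F; 4F; 5F; 6F; 7F)
open import Data.Fin.Properties using (all?; toℕ-inject₁)
open import Data.Fin.Relation.Unary.Top using (view; ‵fromℕ; ‵inject₁)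
open import Data.Nat using (ℕ; zero; suc; pred; _+_; _*_; _∸_; _/_; _≤_; _≥_; _<_; _≡ᵇ_; z≤n; s≤s)
open import Data.Nat.DivMod using (m/n≡1+[m∸n]/n)
open import Data.Nat.Properties
open import Data.Nat.Solver using (module +-*-Solver)
open import Data.Product using (Σ; ∃-syntax; _×_; _,_; curry; uncurry; map₁; map₂)
open import Data.Sum using (_⊎_; inj₁; inj₂)
open import Data.Vec.Functional using (Vector; []; _∷_)
open import Function using (_∘_; id)
open import Relation.Binary.PropositionalEquality
open import Relation.Nullary.Negation using (contradiction)
open import Relation.Nullary.Decidable using (Dec; yes; no; True; toWitness; _⊎-dec_; _→-dec_)

open import Algebra.Properties.Semiring.Sum +-*-semiring
  using (sum; sum-cong-≗; sum-remove; sum-init-last; ∑-distrib-+; ∑-comm; *-distribˡ-sum)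
open +-*-Solver using (solve; _:+_; _:*_; con; _:=_)

∑≡sum : ∀ {m} (f : Fin m → ℕ) → ∑ f ≡ sum f
∑≡sum {zero}  f = refl
∑≡sum {suc m} f = cong (f zero +_) (∑≡sum (f ∘ suc))

∑₂≡sum : ∀ {m n} (g : Fin m × Fin n → ℕ) → ∑₂ g ≡ sum (sum ∘ curry g)
∑₂≡sum g = trans (∑≡sum (∑ ∘ curry g)) (sum-cong-≗ (∑≡sum ∘ curry g))

∑₂-cong : ∀ {m n} {g h : Fin m × Fin n → ℕ} → (∀ u → g u ≡ h u) → ∑₂ g ≡ ∑₂ h
∑₂-cong {g = g} {h} g≗h = begin
  ∑₂ g                ≡⟨ ∑₂≡sum g ⟩
  sum (sum ∘ curry g) ≡⟨ sum-cong-≗ (λ i → sum-cong-≗ (λ j → g≗h (i , j))) ⟩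
  sum (sum ∘ curry h) ≡⟨ ∑₂≡sum h ⟨
  ∑₂ h                ∎
  where open ≡-Reasoning

∑₂-distrib-+ : ∀ {m n} (g h : Fin m × Fin n → ℕ) → ∑₂ (λ u → g u + h u) ≡ ∑₂ g + ∑₂ h
∑₂-distrib-+ g h = begin
  ∑₂ (λ u → g u + h u)                           ≡⟨ ∑₂≡sum (λ u → g u + h u) ⟩
  sum (λ i → sum (λ j → g (i , j) + h (i , j)))  ≡⟨ sum-cong-≗ (λ i → ∑-distrib-+ (curry g i) (curry h i)) ⟩
  sum (λ i → sum (curry g i) + sum (curry h i))  ≡⟨ ∑-distrib-+ (sum ∘ curry g) (sum ∘ curry h) ⟩
  sum (sum ∘ curry g) + sum (sum ∘ curry h)      ≡⟨ cong₂ _+_ (∑₂≡sum g) (∑₂≡sum h) ⟨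
  ∑₂ g + ∑₂ h                                    ∎
  where open ≡-Reasoning

∑₂-distribˡ-* : ∀ {m n} k (g : Fin m × Fin n → ℕ) → k * ∑₂ g ≡ ∑₂ (λ u → k * g u)
∑₂-distribˡ-* k g = begin
  k * ∑₂ g                           ≡⟨ cong (k *_) (∑₂≡sum g) ⟩
  k * sum (sum ∘ curry g)            ≡⟨ *-distribˡ-sum k (sum ∘ curry g) ⟩
  sum (λ i → k * sum (curry g i))    ≡⟨ sum-cong-≗ (λ i → *-distribˡ-sum k (curry g i)) ⟩
  sum (λ i → sum (λ j → k * g (i , j))) ≡⟨ ∑₂≡sum (λ u → k * g u) ⟨
  ∑₂ (λ u → k * g u)                 ∎
  where open ≡-Reasoning

term≤sum : ∀ {m} (f : Fin m → ℕ) i → f i ≤ sum f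
term≤sum {suc _} f i = ≤-trans (m≤m+n _ _) (≤-reflexive (sym (sum-remove {i = i} f)))

term≤∑₂ : ∀ {m n} (g : Fin m × Fin n → ℕ) u → g u ≤ ∑₂ g
term≤∑₂ g (i , j) = begin
  g (i , j)            ≤⟨ term≤sum (curry g i) j ⟩
  sum (curry g i)      ≤⟨ term≤sum (sum ∘ curry g) i ⟩
  sum (sum ∘ curry g)  ≡⟨ ∑₂≡sum g ⟨
  ∑₂ g                 ∎
  where open ≤-Reasoning

sum-const : ∀ m c → sum (λ (_ : Fin m) → c) ≡ m * c
sum-const zero    c = refl
sum-const (suc m) c = cong (c +_) (sum-const m c)

-- Labellings by 0, k and k + 1

indicator-split : ∀ b x → indicator b x ≡ indicator b (positive x) + indicator b (pred x)
indicator-split false x       = refl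
indicator-split true  zero    = refl
indicator-split true  (suc x) = refl

heavy-neighbour : ∀ {m n} k (nbr : Fin m × Fin n → Bool) (f : Fin m × Fin n → ℕ) u →
                  nbr u ≡ true → f u ≡ suc k →
                  k + ∑₂ (λ w → indicator (nbr w) (positive (f w)))
                    ≤ ∑₂ (λ w → indicator (nbr w) (f w))
heavy-neighbour {m} {n} k nbr f u nbr-u fu≡1+k = begin
  k + ∑₂ counted                      ≤⟨ +-monoˡ-≤ (∑₂ counted) k≤∑₂rest ⟩
  ∑₂ rest + ∑₂ counted                ≡⟨ +-comm (∑₂ rest) (∑₂ counted) ⟩
  ∑₂ counted + ∑₂ rest                ≡⟨ ∑₂-distrib-+ counted rest ⟨
  ∑₂ (λ w → counted w + rest w)       ≡⟨ ∑₂-cong (λ w → indicator-split (nbr w) (f w)) ⟨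
  ∑₂ (λ w → indicator (nbr w) (f w))  ∎
  where
  open ≤-Reasoning
  counted rest : Fin m × Fin n → ℕ
  counted w = indicator (nbr w) (positive (f w))
  rest    w = indicator (nbr w) (pred (f w))
  k≤∑₂rest : k ≤ ∑₂ rest
  k≤∑₂rest = subst (_≤ ∑₂ rest) (cong₂ (λ b x → indicator b (pred x)) nbr-u fu≡1+k)
                   (term≤∑₂ rest u)

data Label : Set where
  O K K⁺ : Label

value : ℕ → Label → ℕ
value k O  = 0
value k K  = k
value k K⁺ = suc k

support excess : Label → ℕ
support O = 0
support _ = 1
excess K⁺ = 1
excess _  = 0

value≤1+k : ∀ k l → value k l ≤ suc k
value≤1+k k O  = z≤n
value≤1+k k K  = n≤1+n k
value≤1+k k K⁺ = ≤-refl

value<k⇒O : ∀ k l → value k l < k → l ≡ O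
value<k⇒O k O  _     = refl
value<k⇒O k K  k<k   = contradiction k<k (n≮n k)
value<k⇒O k K⁺ 1+k<k = contradiction (<-trans (n<1+n k) 1+k<k) (n≮n k)

value-split : ∀ k l → value k l ≡ k * support l + excess l
value-split k O  = sym (cong (_+ 0) (*-zeroʳ k))
value-split k K  = sym (trans (+-identityʳ (k * 1)) (*-identityʳ k))
value-split k K⁺ = sym (trans (+-comm (k * 1) 1) (cong suc (*-identityʳ k)))

DominatedByK⁺ : ∀ {m n} → (Fin m × Fin n → Label) → Set
DominatedByK⁺ {m} {n} ℓ = ∀ v → ℓ v ≡ O → ∃[ u ] CPadj m n v u ≡ true × ℓ u ≡ K⁺

dominatedByK⁺⇒isKRDF : ∀ k {m n} (ℓ : Fin m × Fin n → Label) →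
                       DominatedByK⁺ ℓ → IsKRDF-CP k m n (value k ∘ ℓ)
dominatedByK⁺⇒isKRDF k {m} {n} ℓ dominated = (λ v → value≤1+k k (ℓ v)) , λ v v<k →
  let u , adjacent , ℓu≡K⁺ = dominated v (value<k⇒O k (ℓ v) v<k)
  in  ≤-trans (heavy-neighbour k (CPadj m n v) (value k ∘ ℓ) u adjacent (cong (value k) ℓu≡K⁺))
              (m≤n+m _ _)

-- Column patterns on C₈ □ Pₙ

≡ᵇ-refl : ∀ x → (x ≡ᵇ x) ≡ true
≡ᵇ-refl zero    = refl
≡ᵇ-refl (suc x) = ≡ᵇ-refl x

≡⇒≡ᵇ-true : ∀ {x y} → x ≡ y → (x ≡ᵇ y) ≡ true
≡⇒≡ᵇ-true {x} refl = ≡ᵇ-refl x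

∨-introˡ : ∀ {x y} → x ≡ true → x ∨ y ≡ true
∨-introˡ refl = refl

∨-introʳ : ∀ {x y} → y ≡ true → x ∨ y ≡ true
∨-introʳ {true}  _ = refl
∨-introʳ {false} y = y

∧-intro : ∀ {x y} → x ≡ true → y ≡ true → x ∧ y ≡ true
∧-intro refl y = y

column-adjacent : ∀ {m n} (i i′ : Fin m) (j : Fin n) →
                  cycAdj m (toℕ i) (toℕ i′) ≡ true → CPadj m n (i , j) (i′ , j) ≡ true
column-adjacent i i′ j adjacent = ∨-introʳ (∧-intro (≡ᵇ-refl (toℕ j)) adjacent)

next-adjacent : ∀ {m n} (i : Fin m) {j j′ : Fin n} →
                suc (toℕ j) ≡ toℕ j′ → CPadj m n (i , j) (i , j′) ≡ true
next-adjacent i j+1≡j′ =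
  ∨-introˡ (∧-intro (≡ᵇ-refl (toℕ i)) (∨-introˡ (≡⇒≡ᵇ-true j+1≡j′)))

previous-adjacent : ∀ {m n} (i : Fin m) {j j′ : Fin n} →
                    suc (toℕ j′) ≡ toℕ j → CPadj m n (i , j) (i , j′) ≡ true
previous-adjacent i j′+1≡j =
  ∨-introˡ (∧-intro (≡ᵇ-refl (toℕ i)) (∨-introʳ (≡⇒≡ᵇ-true j′+1≡j)))

∀-true-by-decision : ∀ {n} {p : Fin n → Bool} {holds : True (all? (λ i → p i ≟ᵇ true))} →
                     ∀ i → p i ≡ true
∀-true-by-decision {holds = holds} = toWitness holds

Column : Set
Column = Vector Label 8

blank : Column
blank _ = O

up down : Fin 8 → Fin 8
up   = 1F ∷ 2F ∷ 3F ∷ 4F ∷ 5F ∷ 6F ∷ 7F ∷ 0F ∷ []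
down = 7F ∷ 0F ∷ 1F ∷ 2F ∷ 3F ∷ 4F ∷ 5F ∷ 6F ∷ []

up-cycAdj : ∀ i → cycAdj 8 (toℕ i) (toℕ (up i)) ≡ true
up-cycAdj = ∀-true-by-decision

down-cycAdj : ∀ i → cycAdj 8 (toℕ i) (toℕ (down i)) ≡ true
down-cycAdj = ∀-true-by-decision

-- P J R is the column placed at index J when R further columns follow it.
Pattern : Set
Pattern = ℕ → ℕ → Column

position : ∀ {n} → Fin n → ℕ × ℕ
position {n} j = toℕ j , n ∸ suc (toℕ j)

labelling : Pattern → ∀ n → Fin 8 × Fin n → Label
labelling P n (i , j) = uncurry P (position j) i

position-inject₁ : ∀ {n} (j : Fin n) → position (inject₁ j) ≡ map₂ suc (position j)
position-inject₁ zero    = refl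
position-inject₁ (suc j) = cong (map₁ suc) (position-inject₁ j)

position-fromℕ : ∀ n → position (fromℕ n) ≡ (n , 0)
position-fromℕ zero    = refl
position-fromℕ (suc n) = cong (map₁ suc) (position-fromℕ n)

position-sum : ∀ {n} (j : Fin (suc n)) → uncurry _+_ (position j) ≡ n
position-sum zero            = refl
position-sum {suc n} (suc j) = cong suc (position-sum j)

previous following : Pattern → ℕ → ℕ → Column
previous  P zero    R       = blank
previous  P (suc J) R       = P J (suc R)
following P J       zero    = blank
following P J       (suc R) = P (suc J) R

K⁺Nearby : Column → Column → Column → Fin 8 → Set
K⁺Nearby p c x i = c (up i) ≡ K⁺ ⊎ c (down i) ≡ K⁺ ⊎ p i ≡ K⁺ ⊎ x i ≡ K⁺

Covered : Column → Column → Column → Set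
Covered p c x = ∀ i → c i ≡ O → K⁺Nearby p c x i

WellCovered : Pattern → Set
WellCovered P = ∀ J R → 0 < J + R → Covered (previous P J R) (P J R) (following P J R)

previous-K⁺ : ∀ P {n} (j : Fin n) i → uncurry (previous P) (position j) i ≡ K⁺ →
              ∃[ j′ ] suc (toℕ j′) ≡ toℕ j × labelling P n (i , j′) ≡ K⁺
previous-K⁺ P zero    i ()
previous-K⁺ P (suc j) i K⁺-there = inject₁ j , cong suc (toℕ-inject₁ j) ,
  subst (λ p → uncurry P p i ≡ K⁺) (sym (position-inject₁ j)) K⁺-there

following-K⁺ : ∀ P {n} (j : Fin n) i → uncurry (following P) (position j) i ≡ K⁺ →
               ∃[ j′ ] toℕ j′ ≡ suc (toℕ j) × labelling P n (i , j′) ≡ K⁺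
following-K⁺ P {suc n} j i K⁺-there with view j
... | ‵fromℕ     =
  contradiction (subst (λ p → uncurry (following P) p i ≡ K⁺) (position-fromℕ n) K⁺-there) λ ()
... | ‵inject₁ j = suc j , cong suc (sym (toℕ-inject₁ j)) ,
  subst (λ p → uncurry (following P) p i ≡ K⁺) (position-inject₁ j) K⁺-there

wellCovered⇒dominatedByK⁺ : ∀ P {n} → 2 ≤ n → WellCovered P → DominatedByK⁺ (labelling P n)
wellCovered⇒dominatedByK⁺ P (s≤s (s≤s z≤n)) covered (i , j) ℓ≡O
  with covered (toℕ j) _ (subst (0 <_) (sym (position-sum j)) (s≤s z≤n)) i ℓ≡O
... | inj₁ K⁺-up =
  (up i , j) , column-adjacent i (up i) j (up-cycAdj i) , K⁺-up
... | inj₂ (inj₁ K⁺-down) =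
  (down i , j) , column-adjacent i (down i) j (down-cycAdj i) , K⁺-down
... | inj₂ (inj₂ (inj₁ K⁺-prev)) =
  let j′ , j′+1≡j , K⁺-at-j′ = previous-K⁺ P j i K⁺-prev
  in  (i , j′) , previous-adjacent i j′+1≡j , K⁺-at-j′
... | inj₂ (inj₂ (inj₂ K⁺-next)) =
  let j′ , j+1≡j′ , K⁺-at-j′ = following-K⁺ P j i K⁺-next
  in  (i , j′) , next-adjacent i (sym j+1≡j′) , K⁺-at-j′

-- The period-5 pattern

_≟O : ∀ l → Dec (l ≡ O)
O  ≟O = yes refl
K  ≟O = no λ ()
K⁺ ≟O = no λ ()

_≟K⁺ : ∀ l → Dec (l ≡ K⁺)
O  ≟K⁺ = no λ ()
K  ≟K⁺ = no λ ()
K⁺ ≟K⁺ = yes refl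

covered? : ∀ p c x → Dec (Covered p c x)
covered? p c x = all? λ i →
  (c i ≟O) →-dec ((c (up i) ≟K⁺) ⊎-dec (c (down i) ≟K⁺) ⊎-dec (p i ≟K⁺) ⊎-dec (x i ≟K⁺))

covered-by-decision : ∀ {p c x} {holds : True (covered? p c x)} → Covered p c x
covered-by-decision {holds = holds} = toWitness holds

period-5-induction : {P : ℕ → Set} → (∀ j → P j → P (5 + j)) →
                     P 0 → P 1 → P 2 → P 3 → P 4 → ∀ j → P j
period-5-induction step p₀ p₁ p₂ p₃ p₄ 0 = p₀
period-5-induction step p₀ p₁ p₂ p₃ p₄ 1 = p₁
period-5-induction step p₀ p₁ p₂ p₃ p₄ 2 = p₂
period-5-induction step p₀ p₁ p₂ p₃ p₄ 3 = p₃
period-5-induction step p₀ p₁ p₂ p₃ p₄ 4 = p₄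
period-5-induction step p₀ p₁ p₂ p₃ p₄ (suc (suc (suc (suc (suc j))))) =
  step j (period-5-induction step p₀ p₁ p₂ p₃ p₄ j)

first : Column
first = O ∷ K⁺ ∷ O ∷ O ∷ K ∷ O ∷ K⁺ ∷ O ∷ []

middle : ℕ → Column
middle 0 = O  ∷ K⁺ ∷ O  ∷ O  ∷ O  ∷ O  ∷ K⁺ ∷ O  ∷ []
middle 1 = K⁺ ∷ O  ∷ O  ∷ K⁺ ∷ O  ∷ O  ∷ O  ∷ O  ∷ []
middle 2 = O  ∷ K  ∷ O  ∷ O  ∷ O  ∷ K⁺ ∷ O  ∷ O  ∷ []
middle 3 = O  ∷ O  ∷ K⁺ ∷ O  ∷ O  ∷ O  ∷ O  ∷ K⁺ ∷ []
middle 4 = K  ∷ O  ∷ O  ∷ O  ∷ K⁺ ∷ O  ∷ O  ∷ O  ∷ []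
middle (suc (suc (suc (suc (suc j))))) = middle j

last : ℕ → Column
last 0 = O  ∷ K⁺ ∷ O  ∷ K  ∷ O  ∷ O  ∷ K⁺ ∷ O  ∷ []
last 1 = K⁺ ∷ O  ∷ O  ∷ K⁺ ∷ O  ∷ K  ∷ O  ∷ O  ∷ []
last 2 = K⁺ ∷ O  ∷ K  ∷ O  ∷ O  ∷ K⁺ ∷ O  ∷ O  ∷ []
last 3 = O  ∷ O  ∷ K⁺ ∷ O  ∷ K  ∷ O  ∷ O  ∷ K⁺ ∷ []
last 4 = K⁺ ∷ O  ∷ O  ∷ O  ∷ K⁺ ∷ O  ∷ K  ∷ O  ∷ []
last (suc (suc (suc (suc (suc j))))) = last j

pattern₈ : Pattern
pattern₈ J       zero    = last J
pattern₈ zero    (suc R) = first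
pattern₈ (suc J) (suc R) = middle (suc J)

inner-covered : ∀ j → Covered (middle (1 + j)) (middle (2 + j)) (middle (3 + j))
inner-covered = period-5-induction (λ _ → id)
  covered-by-decision covered-by-decision covered-by-decision
  covered-by-decision covered-by-decision

penultimate-covered : ∀ j → Covered (middle (1 + j)) (middle (2 + j)) (last (3 + j))
penultimate-covered = period-5-induction (λ _ → id)
  covered-by-decision covered-by-decision covered-by-decision
  covered-by-decision covered-by-decision

last-covered : ∀ j → Covered (middle (1 + j)) (last (2 + j)) blank
last-covered = period-5-induction (λ _ → id)
  covered-by-decision covered-by-decision covered-by-decision
  covered-by-decision covered-by-decision

pattern₈-wellCovered : WellCovered pattern₈
pattern₈-wellCovered zero          zero          ()
pattern₈-wellCovered zero          (suc zero)    _ = covered-by-decision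
pattern₈-wellCovered zero          (suc (suc R)) _ = covered-by-decision
pattern₈-wellCovered (suc zero)    zero          _ = covered-by-decision
pattern₈-wellCovered (suc zero)    (suc zero)    _ = covered-by-decision
pattern₈-wellCovered (suc zero)    (suc (suc R)) _ = covered-by-decision
pattern₈-wellCovered (suc (suc j)) zero          _ = last-covered j
pattern₈-wellCovered (suc (suc j)) (suc zero)    _ = penultimate-covered j
pattern₈-wellCovered (suc (suc j)) (suc (suc R)) _ = inner-covered j

weight-value-split : ∀ k {m n} (ℓ : Fin m × Fin n → Label) →
                     weight (value k ∘ ℓ) ≡ k * weight (support ∘ ℓ) + weight (excess ∘ ℓ)
weight-value-split k ℓ = begin
  weight (value k ∘ ℓ)
    ≡⟨ ∑₂-cong (λ u → value-split k (ℓ u)) ⟩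
  ∑₂ (λ u → k * support (ℓ u) + excess (ℓ u))
    ≡⟨ ∑₂-distrib-+ (λ u → k * support (ℓ u)) (excess ∘ ℓ) ⟩
  ∑₂ (λ u → k * support (ℓ u)) + weight (excess ∘ ℓ)
    ≡⟨ cong (_+ weight (excess ∘ ℓ)) (∑₂-distribˡ-* k (support ∘ ℓ)) ⟨
  k * weight (support ∘ ℓ) + weight (excess ∘ ℓ) ∎
  where open ≡-Reasoning

columnSum : (Label → ℕ) → Column → ℕ
columnSum g c = sum (g ∘ c)

weight-by-columns : ∀ (g : Label → ℕ) P n →
                    weight (g ∘ labelling P n)
                      ≡ sum (λ (j : Fin n) → columnSum g (uncurry P (position j)))
weight-by-columns g P n =
  trans (∑₂≡sum (g ∘ labelling P n))
        (∑-comm (λ (i : Fin 8) (j : Fin n) → g (uncurry P (position j) i)))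

sum-by-position : ∀ m (h : ℕ → ℕ → ℕ) →
                  sum (λ (j : Fin (2 + m)) → uncurry h (position j))
                    ≡ h 0 (suc m) + (sum (λ (j : Fin m) → h (suc (toℕ j)) (suc (m ∸ suc (toℕ j))))
                                      + h (suc m) 0)
sum-by-position m h = cong (h 0 (suc m) +_) (begin
  sum inner
    ≡⟨ sum-init-last inner ⟩
  sum (inner ∘ inject₁) + inner (fromℕ m)
    ≡⟨ cong₂ _+_ (sum-cong-≗ {x = inner ∘ inject₁} (λ j → cong shifted (position-inject₁ j)))
                 (cong shifted (position-fromℕ m)) ⟩
  sum (λ (j : Fin m) → h (suc (toℕ j)) (suc (m ∸ suc (toℕ j)))) + h (suc m) 0 ∎)
  where
  open ≡-Reasoning
  shifted : ℕ × ℕ → ℕ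
  shifted = uncurry h ∘ map₁ suc
  inner : Fin (suc m) → ℕ
  inner j = shifted (position j)

pattern₈-column-sums : ∀ (g : Label → ℕ) m →
  weight (g ∘ labelling pattern₈ (2 + m))
    ≡ columnSum g first + (sum (λ (j : Fin m) → columnSum g (middle (suc (toℕ j))))
                           + columnSum g (last (suc m)))
pattern₈-column-sums g m =
  trans (weight-by-columns g pattern₈ (2 + m))
        (sum-by-position m (λ J R → columnSum g (pattern₈ J R)))

middle-support : ∀ j → columnSum support (middle j) ≡ 2
middle-support = period-5-induction (λ _ → id) refl refl refl refl refl

last-support : ∀ j → columnSum support (last j) ≡ 3
last-support = period-5-induction (λ _ → id) refl refl refl refl refl

last-excess : ∀ j → columnSum excess (last j) ≡ 2
last-excess = period-5-induction (λ _ → id) refl refl refl refl refl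

middleExcess : ℕ → ℕ
middleExcess m = sum (λ (j : Fin m) → columnSum excess (middle (suc (toℕ j))))

pattern₈-support : ∀ m → weight (support ∘ labelling pattern₈ (2 + m)) ≡ 3 + (m * 2 + 3)
pattern₈-support m = begin
  weight (support ∘ labelling pattern₈ (2 + m))
    ≡⟨ pattern₈-column-sums support m ⟩
  3 + (sum middles + columnSum support (last (suc m)))
    ≡⟨ cong₂ (λ a b → 3 + (a + b))
             (sum-cong-≗ {x = middles} (λ j → middle-support (suc (toℕ j))))
             (last-support (suc m)) ⟩
  3 + (sum (λ (_ : Fin m) → 2) + 3)
    ≡⟨ cong (λ a → 3 + (a + 3)) (sum-const m 2) ⟩
  3 + (m * 2 + 3) ∎
  where
  open ≡-Reasoning
  middles : Fin m → ℕ
  middles j = columnSum support (middle (suc (toℕ j)))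

pattern₈-excess : ∀ m → weight (excess ∘ labelling pattern₈ (2 + m)) ≡ 2 + (middleExcess m + 2)
pattern₈-excess m =
  trans (pattern₈-column-sums excess m)
        (cong (λ b → 2 + (middleExcess m + b)) (last-excess (suc m)))

[5+m]/5≡1+m/5 : ∀ m → (5 + m) / 5 ≡ 1 + m / 5
[5+m]/5≡1+m/5 m = m/n≡1+[m∸n]/n (m≤m+n 5 m)

middleExcess-bound : ∀ m → middleExcess m + (m / 5 + (2 + m) / 5) ≤ 2 * m
middleExcess-bound =
  period-5-induction step (≤ᵇ⇒≤ _ _ _) (≤ᵇ⇒≤ _ _ _) (≤ᵇ⇒≤ _ _ _) (≤ᵇ⇒≤ _ _ _) (≤ᵇ⇒≤ _ _ _)
  where
  step : ∀ m → middleExcess m + (m / 5 + (2 + m) / 5) ≤ 2 * m →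
         middleExcess (5 + m) + ((5 + m) / 5 + (5 + (2 + m)) / 5) ≤ 2 * (5 + m)
  step m bound = begin
    8 + middleExcess m + ((5 + m) / 5 + (5 + (2 + m)) / 5)
      ≡⟨ cong₂ (λ a b → 8 + middleExcess m + (a + b)) ([5+m]/5≡1+m/5 m) ([5+m]/5≡1+m/5 (2 + m)) ⟩
    8 + middleExcess m + ((1 + m / 5) + (1 + (2 + m) / 5))
      ≡⟨ solve 3 (λ e a b → con 8 :+ e :+ ((con 1 :+ a) :+ (con 1 :+ b))
                         := con 10 :+ (e :+ (a :+ b)))
               refl (middleExcess m) (m / 5) ((2 + m) / 5) ⟩
    10 + (middleExcess m + (m / 5 + (2 + m) / 5))
      ≤⟨ +-monoʳ-≤ 10 bound ⟩
    10 + 2 * m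
      ≡⟨ *-distribˡ-+ 2 5 m ⟨
    2 * (5 + m) ∎
    where open ≤-Reasoning

pattern₈-weight-bound : ∀ k m →
  weight (value k ∘ labelling pattern₈ (2 + m))
    ≤ (2 * (2 + m) * (k + 1) ∸ (m / 5 + (2 + m) / 5)) + 2 * k
pattern₈-weight-bound k m = begin
  weight (value k ∘ ℓ)
    ≡⟨ weight-value-split k ℓ ⟩
  k * weight (support ∘ ℓ) + weight (excess ∘ ℓ)
    ≡⟨ cong₂ (λ a b → k * a + b) (pattern₈-support m) (pattern₈-excess m) ⟩
  k * (3 + (m * 2 + 3)) + (2 + (X + 2))
    ≡⟨ solve 3 (λ k m X → k :* (con 3 :+ (m :* con 2 :+ con 3)) :+ (con 2 :+ (X :+ con 2))
                       := k :* (m :* con 2 :+ con 4) :+ (con 4 :+ X) :+ con 2 :* k)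
             refl k m X ⟩
  k * (m * 2 + 4) + (4 + X) + 2 * k
    ≤⟨ +-monoˡ-≤ (2 * k) (m+n≤o⇒m≤o∸n (k * (m * 2 + 4) + (4 + X)) bound-without-2k) ⟩
  (2 * (2 + m) * (k + 1) ∸ s) + 2 * k ∎
  where
  open ≤-Reasoning
  ℓ : Fin 8 × Fin (2 + m) → Label
  ℓ = labelling pattern₈ (2 + m)
  X s : ℕ
  X = middleExcess m
  s = m / 5 + (2 + m) / 5
  bound-without-2k : k * (m * 2 + 4) + (4 + X) + s ≤ 2 * (2 + m) * (k + 1)
  bound-without-2k = begin
    k * (m * 2 + 4) + (4 + X) + s
      ≡⟨ solve 4 (λ k m X s → k :* (m :* con 2 :+ con 4) :+ (con 4 :+ X) :+ s
                           := k :* (m :* con 2 :+ con 4) :+ con 4 :+ (X :+ s))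
               refl k m X s ⟩
    k * (m * 2 + 4) + 4 + (X + s)
      ≤⟨ +-monoʳ-≤ (k * (m * 2 + 4) + 4) (middleExcess-bound m) ⟩
    k * (m * 2 + 4) + 4 + 2 * m
      ≡⟨ solve 2 (λ k m → k :* (m :* con 2 :+ con 4) :+ con 4 :+ con 2 :* m
                       := con 2 :* (con 2 :+ m) :* (k :+ con 1))
               refl k m ⟩
    2 * (2 + m) * (k + 1) ∎

theorem19 : (n k : ℕ) → n ≥ 2 → k ≥ 1 →
    Σ (Fin 8 × Fin n → ℕ) λ f → IsKRDF-CP k 8 n f ×
      (weight f ≤ (2 * n * (k + 1) ∸ ((n ∸ 2) / 5 + n / 5)) + 2 * k)
-- The construction works for every k.
theorem19 n@(suc (suc m)) k n≥2 _ =
  value k ∘ ℓ ,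
  dominatedByK⁺⇒isKRDF k ℓ (wellCovered⇒dominatedByK⁺ pattern₈ n≥2 pattern₈-wellCovered) ,
  pattern₈-weight-bound k m
  where
  ℓ : Fin 8 × Fin n → Label
  ℓ = labelling pattern₈ n
theorem19 1 _ (s≤s ()) _
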